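{- Let $\Gamma$ be a graph, $\epsilon$ an end of $\Gamma$, $X\subseteq V(\Gamma)$ finite, and let $\mathcal{R}=(R_i: i\in I)$ and $\mathcal{S}=(S_j: j\in J)$ be two finite families of disjoint $\epsilon$-rays with $|I|\le|J|$. Then there is a finite subgraph $Y$ of $\Gamma$ such that for any transition function $\sigma$ from $\mathcal{R}$ to $\mathcal{S}$ there is a linkage $\mathcal{P}_\sigma$ from $\mathcal{R}$ to $\mathcal{S}$ inducing $\sigma$, with $\bigcup\mathcal{P}_\sigma\subseteq Y$, which is after $X$.
   Context: For families $\mathcal{R}=(R_i:i\in I)$, $\mathcal{S}=(S_j:j\in J)$ of disjoint rays, with $x_i$ the initial vertex of $R_i$, a linkage from $\mathcal{R}$ to $\mathcal{S}$ is a family of paths $(P_i:i\in I)$ together with an injective $\sigma\colon I\to J$ (the map it induces) such that each $P_i$ goes from a vertex $x_i'\in R_i$ to a vertex $y_{\sigma(i)}\in S_{\sigma(i)}$ and the rays $x_iR_ix_i'P_iy_{\sigma(i)}S_{\sigma(i)}$ ($i\in I$) are pairwise disjoint. It is after a vertex set $X$ if $X\cap V(R_i)\subseteq V(x_iR_ix_i')$ for all $i$ and no other vertex of $X$ lies on these rays. A function $\sigma\colon I\to J$ is a transition function from $\mathcal{R}$ to $\mathcal{S}$ if for every finite vertex set $X$ there is a linkage from $\mathcal{R}$ to $\mathcal{S}$ after $X$ inducing $\sigma$. -}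

module Defs where

open import Level using (Level; _⊔_) renaming (suc to lsuc)
open import Data.Nat using (ℕ; zero; suc; _+_; _≤_; _<_; _≥_)
open import Data.Fin using (Fin)
open import Data.List using (List)
open import Data.List.Membership.Propositional using (_∈_; _∉_)
open import Data.Product using (Σ; ∃; _×_; _,_)
open import Data.Sum using (_⊎_)
open import Relation.Nullary using (¬_)
open import Relation.Binary.PropositionalEquality using (_≡_; _≢_)

record Graph (ℓ : Level) : Set (lsuc ℓ) where
  field
    V     : Set ℓ
    _~_   : V → V → Set ℓ
    ~-sym : ∀ {x y} → x ~ y → y ~ x
    ~-irr : ∀ {x} → ¬ (x ~ x)

module _ {ℓ : Level} (Γ : Graph ℓ) where
  open Graph Γ

  record Ray : Set ℓ where
    field
      vtx : ℕ → V
      inj : ∀ {k l} → vtx k ≡ vtx l → k ≡ l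
      adj : ∀ k → vtx k ~ vtx (suc k)
  open Ray public

  -- A finite path v₀ … v_len, given by vtx on the indices 0 … len
  -- (values at indices > len are irrelevant).
  record Path : Set ℓ where
    field
      len  : ℕ
      pvtx : ℕ → V
      pinj : ∀ {k l} → k ≤ len → l ≤ len → pvtx k ≡ pvtx l → k ≡ l
      padj : ∀ k → k < len → pvtx k ~ pvtx (suc k)
  open Path public

  FinVSet : Set ℓ
  FinVSet = List V

  -- Equivalence of rays (Diestel): for every finite X, the rays have tails
  -- in the same component of Γ - X, i.e. tails avoiding X joined by a path avoiding X.
  RayEquiv : Ray → Ray → Set ℓ
  RayEquiv R S = (X : FinVSet) → Σ ℕ λ k → Σ ℕ λ l →
      (∀ k' → k ≤ k' → vtx R k' ∉ X)
    × (∀ l' → l ≤ l' → vtx S l' ∉ X)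
    × Σ Path λ P → pvtx P 0 ≡ vtx R k × pvtx P (len P) ≡ vtx S l
                  × (∀ t → t ≤ len P → pvtx P t ∉ X)

  -- An end is an equivalence class of rays; we represent an end by a ray ε
  -- belonging to it. An ε-ray is a ray equivalent to ε.
  IsEndRay : Ray → Ray → Set ℓ
  IsEndRay ε R = RayEquiv R ε

  DisjointRays : ∀ {m} → (Fin m → Ray) → Set ℓ
  DisjointRays {m} R = ∀ (i j : Fin m) → i ≢ j → ∀ k l → vtx (R i) k ≢ vtx (R j) l

  -- For each i, path P_i runs from
  -- x_i' = R_i(a_i) to y_σ(i) = S_σ(i)(b_i); ray i is the concatenation
  -- x_i R_i x_i' P_i y_σ(i) S_σ(i), and these rays are pairwise disjoint.
  record Linkage {m n : ℕ} (R : Fin m → Ray) (S : Fin n → Ray) (σ : Fin m → Fin n) : Set ℓ where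
    field
      σ-inj    : ∀ {i j} → σ i ≡ σ j → i ≡ j
      path     : Fin m → Path
      a        : Fin m → ℕ
      b        : Fin m → ℕ
      ray      : Fin m → Ray
      ray-init : ∀ i k → k ≤ a i → vtx (ray i) k ≡ vtx (R i) k
      ray-path : ∀ i t → t ≤ len (path i) → vtx (ray i) (a i + t) ≡ pvtx (path i) t
      ray-tail : ∀ i k → vtx (ray i) (a i + len (path i) + k) ≡ vtx (S (σ i)) (b i + k)
      disjoint : ∀ i j → i ≢ j → ∀ k l → vtx (ray i) k ≢ vtx (ray j) l
  open Linkage public

  -- The linkage is after X: X ∩ V(R_i) ⊆ V(x_i R_i x_i'), and no other vertex of X
  -- lies on the rays x_i R_i x_i' P_i y S, i.e. X meets each such ray only in x_i R_i x_i'.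
  LinkageAfter : ∀ {m n} {R : Fin m → Ray} {S : Fin n → Ray} {σ : Fin m → Fin n}
               → FinVSet → Linkage R S σ → Set ℓ
  LinkageAfter {R = R} X L = ∀ i →
      (∀ k → vtx (R i) k ∈ X → k ≤ a L i)
    × (∀ k → vtx (ray L i) k ∈ X → k ≤ a L i)

  IsTransition : ∀ {m n} → (Fin m → Ray) → (Fin n → Ray) → (Fin m → Fin n) → Set ℓ
  IsTransition R S σ = (X : FinVSet) → Σ (Linkage R S σ) λ L → LinkageAfter X L

  -- A finite subgraph: finitely many vertices and finitely many edges of Γ
  -- (edges as ordered pairs, with endpoints among the vertices).
  record FinSubgraph : Set ℓ where
    field
      sverts : List V
      sedges : List (V × V)
      sedges-ok : ∀ {u v} → (u , v) ∈ sedges → (u ~ v) × (u ∈ sverts) × (v ∈ sverts)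
  open FinSubgraph public

  LinkageWithin : ∀ {m n} {R : Fin m → Ray} {S : Fin n → Ray} {σ : Fin m → Fin n}
                → Linkage R S σ → FinSubgraph → Set ℓ
  LinkageWithin L Y = ∀ i →
      (∀ t → t ≤ len (path L i) → pvtx (path L i) t ∈ sverts Y)
    × (∀ t → t < len (path L i) →
         ((pvtx (path L i) t , pvtx (path L i) (suc t)) ∈ sedges Y)
       ⊎ ((pvtx (path L i) (suc t) , pvtx (path L i) t) ∈ sedges Y))

{-# OPTIONS --safe #-}
module Submission where

-- There are only finitely many maps I → J. For each of them that is a
-- transition function, fix one linkage after X inducing it; the union of
-- the paths of these finitely many linkages is the required finite Y.
-- Which maps are transition functions is not decidable, so the choice uses
-- excluded middle.

open import Defs
open import Level using (Level)
open import Data.Nat using (ℕ; zero; suc; _+_; _≤_; s≤s)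
open import Data.Nat.Properties using (m<n⇒m<1+n)
open import Data.Fin using (Fin; zero; suc)
open import Data.Product using (Σ; _×_; _,_; proj₁; proj₂)
open import Data.Sum using (_⊎_; inj₁; inj₂)
open import Data.List using (List; []; _∷_; _++_; map; applyUpTo; allFin; cartesianProductWith; [_])
open import Data.List.Membership.Propositional using (_∈_; find; lose)
open import Data.List.Membership.Propositional.Properties
  using (∈-++⁻; ∈-++⁺ˡ; ∈-++⁺ʳ; ∈-map⁺; ∈-allFin; ∈-applyUpTo⁺; ∈-applyUpTo⁻; ∈-cartesianProductWith⁺)
open import Data.List.Relation.Unary.Any using (here; there)
open import Data.List.Relation.Unary.Enumerates.Setoid using (IsEnumeration)
open import Data.Vec.Functional using () renaming (_∷_ to _∷ᵛ_)
open import Relation.Nullary using (Dec; yes; no; contradiction)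
open import Function using (_∘_)
open import Relation.Binary.PropositionalEquality using (_≡_; refl; sym; trans; subst; _≗_; _→-setoid_)
open import Axiom.ExcludedMiddle using (ExcludedMiddle)

allFunctions : ∀ m n → List (Fin m → Fin n)
allFunctions zero    n = [ (λ ()) ]
allFunctions (suc m) n = cartesianProductWith _∷ᵛ_ (allFin n) (allFunctions m n)

allFunctions-isEnumeration : ∀ m n → IsEnumeration (Fin m →-setoid Fin n) (allFunctions m n)
allFunctions-isEnumeration zero    n σ = here (λ ())
allFunctions-isEnumeration (suc m) n σ
  with find (allFunctions-isEnumeration m n (λ i → σ (suc i)))
... | τ , τ∈ , σ∘suc≗τ =
  lose (∈-cartesianProductWith⁺ _∷ᵛ_ (∈-allFin (σ zero)) τ∈) λ where
    zero    → refl
    (suc i) → σ∘suc≗τ i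

module FinSubgraphs {ℓ : Level} (Γ : Graph ℓ) where
  open Graph Γ

  infix 4 _⊆ᴳ_
  _⊆ᴳ_ : FinSubgraph Γ → FinSubgraph Γ → Set ℓ
  G ⊆ᴳ H = (∀ {v} → v ∈ sverts G → v ∈ sverts H)
         × (∀ {e} → e ∈ sedges G → e ∈ sedges H)

  ∅ᴳ : FinSubgraph Γ
  ∅ᴳ = record { sverts = [] ; sedges = [] ; sedges-ok = λ () }

  infixr 5 _∪ᴳ_
  _∪ᴳ_ : FinSubgraph Γ → FinSubgraph Γ → FinSubgraph Γ
  G ∪ᴳ H = record
    { sverts    = sverts G ++ sverts H
    ; sedges    = sedges G ++ sedges H
    ; sedges-ok = λ e∈ → edge-ok (∈-++⁻ (sedges G) e∈)
    }
    where
    edge-ok : ∀ {u v} → (u , v) ∈ sedges G ⊎ (u , v) ∈ sedges H →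
              (u ~ v) × (u ∈ sverts G ++ sverts H) × (v ∈ sverts G ++ sverts H)
    edge-ok (inj₁ e∈) with sedges-ok G e∈
    ... | u~v , u∈ , v∈ = u~v , ∈-++⁺ˡ u∈ , ∈-++⁺ˡ v∈
    edge-ok (inj₂ e∈) with sedges-ok H e∈
    ... | u~v , u∈ , v∈ = u~v , ∈-++⁺ʳ (sverts G) u∈ , ∈-++⁺ʳ (sverts G) v∈

  ⋃ᴳ : List (FinSubgraph Γ) → FinSubgraph Γ
  ⋃ᴳ []       = ∅ᴳ
  ⋃ᴳ (G ∷ Gs) = G ∪ᴳ ⋃ᴳ Gs

  ∈⇒⊆⋃ᴳ : ∀ {G Gs} → G ∈ Gs → G ⊆ᴳ ⋃ᴳ Gs
  ∈⇒⊆⋃ᴳ (here refl) = ∈-++⁺ˡ , ∈-++⁺ˡ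
  ∈⇒⊆⋃ᴳ {Gs = H ∷ _} (there G∈) with ∈⇒⊆⋃ᴳ G∈
  ... | verts⊆ , edges⊆ = (λ v∈ → ∈-++⁺ʳ (sverts H) (verts⊆ v∈))
                        , (λ e∈ → ∈-++⁺ʳ (sedges H) (edges⊆ e∈))

  pathSubgraph : Path Γ → FinSubgraph Γ
  pathSubgraph P = record
    { sverts    = applyUpTo (pvtx P) (suc (len P))
    ; sedges    = applyUpTo pathEdge (len P)
    ; sedges-ok = edge-ok
    }
    where
    pathEdge : ℕ → V × V
    pathEdge t = pvtx P t , pvtx P (suc t)

    edge-ok : ∀ {u v} → (u , v) ∈ applyUpTo pathEdge (len P) →
              (u ~ v) × (u ∈ applyUpTo (pvtx P) (suc (len P))) × (v ∈ applyUpTo (pvtx P) (suc (len P)))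
    edge-ok e∈ with ∈-applyUpTo⁻ pathEdge e∈
    ... | t , t<len , refl = padj P t t<len
                           , ∈-applyUpTo⁺ (pvtx P) (m<n⇒m<1+n t<len)
                           , ∈-applyUpTo⁺ (pvtx P) (s≤s t<len)

  module _ {m n : ℕ} {R : Fin m → Ray Γ} {S : Fin n → Ray Γ} where

    linkageSubgraph : ∀ {σ} → Linkage Γ R S σ → FinSubgraph Γ
    linkageSubgraph L = ⋃ᴳ (map (λ i → pathSubgraph (path L i)) (allFin m))

    linkageWithin-⊆ᴳ : ∀ {σ} (L : Linkage Γ R S σ) Y → linkageSubgraph L ⊆ᴳ Y → LinkageWithin Γ L Y
    linkageWithin-⊆ᴳ L Y (verts⊆ , edges⊆) i =
        (λ t t≤len → verts⊆ (proj₁ pathSubgraph⊆ (∈-applyUpTo⁺ (pvtx (path L i)) (s≤s t≤len))))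
      , (λ t t<len → inj₁ (edges⊆ (proj₂ pathSubgraph⊆ (∈-applyUpTo⁺ _ t<len))))
      where
      pathSubgraph⊆ : pathSubgraph (path L i) ⊆ᴳ linkageSubgraph L
      pathSubgraph⊆ = ∈⇒⊆⋃ᴳ (∈-map⁺ (λ j → pathSubgraph (path L j)) (∈-allFin i))

    linkage-resp-≗ : ∀ {σ τ} → σ ≗ τ → Linkage Γ R S σ → Linkage Γ R S τ
    linkage-resp-≗ σ≗τ L = record
      { σ-inj    = λ {i} {j} τi≡τj → σ-inj L (trans (σ≗τ i) (trans τi≡τj (sym (σ≗τ j))))
      ; path     = path L
      ; a        = a L
      ; b        = b L
      ; ray      = ray L
      ; ray-init = ray-init L
      ; ray-path = ray-path L
      ; ray-tail = λ i k → subst (λ j → _ ≡ vtx (S j) (b L i + k)) (σ≗τ i) (ray-tail L i k)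
      ; disjoint = disjoint L
      }

    isTransition-resp-≗ : ∀ {σ τ} → σ ≗ τ → IsTransition Γ R S σ → IsTransition Γ R S τ
    isTransition-resp-≗ σ≗τ isTrans X with isTrans X
    ... | L , after = linkage-resp-≗ σ≗τ L , after

lemma3p17 : ∀ {ℓ : Level} → ExcludedMiddle ℓ →
    (Γ : Graph ℓ) (ε : Ray Γ) (X : FinVSet Γ) {m n : ℕ}
    (R : Fin m → Ray Γ) (S : Fin n → Ray Γ) →
    DisjointRays Γ R → DisjointRays Γ S →
    (∀ i → IsEndRay Γ ε (R i)) → (∀ j → IsEndRay Γ ε (S j)) →
    m ≤ n →
    Σ (FinSubgraph Γ) λ Y → ∀ (σ : Fin m → Fin n) → IsTransition Γ R S σ →
    Σ (Linkage Γ R S σ) λ P → LinkageWithin Γ P Y × LinkageAfter Γ X P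
lemma3p17 lem Γ ε X {m} {n} R S _ _ _ _ _ = Y , linkageInY
  where
  open FinSubgraphs Γ

  chosenSubgraph : ∀ {σ} → Dec (IsTransition Γ R S σ) → FinSubgraph Γ
  chosenSubgraph (yes isTrans) = linkageSubgraph (proj₁ (isTrans X))
  chosenSubgraph (no _)        = ∅ᴳ

  Y : FinSubgraph Γ
  Y = ⋃ᴳ (map (λ σ → chosenSubgraph {σ} lem) (allFunctions m n))

  fromChosen : ∀ {σ τ} → σ ≗ τ → IsTransition Γ R S τ →
               (d : Dec (IsTransition Γ R S σ)) → chosenSubgraph d ⊆ᴳ Y →
               Σ (Linkage Γ R S τ) λ P → LinkageWithin Γ P Y × LinkageAfter Γ X P
  fromChosen σ≗τ _ (yes isTrans) chosen⊆Y with isTrans X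
  ... | L , after = linkage-resp-≗ σ≗τ L , linkageWithin-⊆ᴳ L Y chosen⊆Y , after
  fromChosen σ≗τ τ-trans (no ¬σ-trans) _ =
    contradiction (isTransition-resp-≗ (sym ∘ σ≗τ) τ-trans) ¬σ-trans

  linkageInY : ∀ τ → IsTransition Γ R S τ →
               Σ (Linkage Γ R S τ) λ P → LinkageWithin Γ P Y × LinkageAfter Γ X P
  linkageInY τ τ-trans with find (allFunctions-isEnumeration m n τ)
  ... | σ , σ∈ , τ≗σ = fromChosen (sym ∘ τ≗σ) τ-trans lem (∈⇒⊆⋃ᴳ (∈-map⁺ _ σ∈))
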